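{- Let $G=(V,E)$ be a finite undirected simple graph, let $W\subseteq V$ and let $s\in W$. The number of orientations of $E$ in which every vertex of $W$ is reachable from $s$ by a directed path equals the number of subsets $X\subseteq E$ such that all vertices of $W$ lie in the same connected component of the graph $(V,X)$.
   Context: An orientation of $E$ assigns to each edge one of its two possible directions; there are $2^{|E|}$ orientations. -}

module Defs where

open import Data.Nat using (ℕ; zero; suc)
open import Data.Bool using (Bool; true; false)
open import Data.Fin using (Fin)
open import Data.Fin.Subset using (Subset; _∈_)
open import Data.Vec using (Vec; []; _∷_)
open import Data.List using (List; []; _∷_; _++_; map; length; filter)
open import Data.Product using (Σ; ∃; _×_; _,_)
open import Data.Sum using (_⊎_)
open import Relation.Binary.PropositionalEquality using (_≡_; _≢_)
open import Relation.Binary.Construct.Closure.ReflexiveTransitive using (Star)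
open import Relation.Unary using (Pred; Decidable)
open import Level using (0ℓ)

-- Its edge set E is indexed by Fin m; edge e has the (unordered) endpoint
-- pair given by `ends e` (the order of the pair is only a reference
-- direction used to encode orientations).
record SimpleGraph (n : ℕ) : Set where
  field
    m        : ℕ
    ends     : Fin m → Fin n × Fin n
    loopless : ∀ e u v → ends e ≡ (u , v) → u ≢ v
    noMulti  : ∀ e f u v → ends e ≡ (u , v) →
               (ends f ≡ (u , v) ⊎ ends f ≡ (v , u)) → e ≡ f

open SimpleGraph public

-- An orientation assigns to each edge one of its two directions:
-- true = from (proj₁ ends e) to (proj₂ ends e), false = reverse.
Orientation : ∀ {n} → SimpleGraph n → Set
Orientation G = Vec Bool (m G)

EdgeSubset : ∀ {n} → SimpleGraph n → Set
EdgeSubset G = Subset (m G)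

Arc : ∀ {n} (G : SimpleGraph n) → Orientation G → Fin n → Fin n → Set
Arc G o u v = ∃ λ e →
  (Data.Vec.lookup o e ≡ true × ends G e ≡ (u , v)) ⊎
  (Data.Vec.lookup o e ≡ false × ends G e ≡ (v , u))

Reachable : ∀ {n} (G : SimpleGraph n) → Orientation G → Fin n → Fin n → Set
Reachable G o = Star (Arc G o)

AdjIn : ∀ {n} (G : SimpleGraph n) → EdgeSubset G → Fin n → Fin n → Set
AdjIn G X u v = ∃ λ e → e ∈ X × (ends G e ≡ (u , v) ⊎ ends G e ≡ (v , u))

ConnectedIn : ∀ {n} (G : SimpleGraph n) → EdgeSubset G → Fin n → Fin n → Set
ConnectedIn G X = Star (AdjIn G X)

allVecs : (k : ℕ) → List (Vec Bool k)
allVecs zero    = [] ∷ []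
allVecs (suc k) = map (true ∷_) (allVecs k) ++ map (false ∷_) (allVecs k)

count : ∀ {k} {P : Pred (Vec Bool k) 0ℓ} → Decidable P → ℕ
count {k} P? = length (filter P? (allVecs k))

AllReachable : ∀ {n} (G : SimpleGraph n) (W : Subset n) (s : Fin n) →
               Pred (Orientation G) 0ℓ
AllReachable G W s o = ∀ w → w ∈ W → Reachable G o s w

WInOneComponent : ∀ {n} (G : SimpleGraph n) (W : Subset n) →
                  Pred (EdgeSubset G) 0ℓ
WInOneComponent G W X = ∀ u v → u ∈ W → v ∈ W → ConnectedIn G X u v

-- Process the edges one at a time, keeping each processed edge as extra arcs K of the rest.
-- For an edge uv let A, B say that s reaches all of W once the arc u→v, resp. v→u, is
-- added.  A ∨ B holds iff s reaches W with both arcs added: if s reaches u without the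
-- edge, u→v suffices; if it reaches v, v→u does; otherwise the edge is useless.  A ∧ B
-- holds iff s reaches W with neither arc: a path first using u→v has reached u, one first
-- using v→u has reached v, and once s reaches both ends the edge can be bypassed.  So
-- [A] + [B] = [A ∨ B] + [A ∧ B] splits the orientations exactly as the subsets X split on
-- whether uv ∈ X (K gains both arcs, or nothing).  With no edge left K is symmetric, and
-- then reaching all of W from s ∈ W means that W lies in one component.
module Submission where

open import Data.Nat using (ℕ; zero; suc; _+_)
open import Data.Nat.Properties using (+-suc)
open import Data.Bool using (Bool; true; false)
open import Data.Fin using (Fin; zero; suc)
open import Data.Fin.Properties using (¬Fin0)
open import Data.Fin.Subset using (Subset; _∈_)
open import Data.Vec using (Vec; []; _∷_; lookup; here; there)
open import Data.List using (List; []; _∷_; _++_; map; length; filter)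
open import Data.List.Properties using (filter-++; length-++; filter-≐)
open import Data.Product using (∃; _×_; _,_; proj₁; proj₂; swap)
open import Data.Sum as Sum using (_⊎_; inj₁; inj₂; [_,_]′; assocʳ; assocˡ)
open import Data.Empty using (⊥-elim)
open import Function using (_∘_)
open import Function.Bundles using (_⇔_; mk⇔; Equivalence)
open import Function.Properties.Equivalence using () renaming (trans to ⇔-trans)
open import Data.Sum.Function.Propositional using (_⊎-⇔_)
open import Data.Product.Function.NonDependent.Propositional using (_×-⇔_)
open import Level using (0ℓ)
open import Relation.Nullary using (¬_; yes; no; does)
open import Relation.Nullary.Decidable using (Dec; decidable-stable; ¬¬-excluded-middle; _⊎-dec_)
import Relation.Nullary.Decidable as Dec
open import Relation.Unary using (Pred; Decidable)
open import Relation.Unary.Properties using (_∪?_; _∩?_)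
open import Relation.Binary.Core using (Rel; _⇒_)
open import Relation.Binary.Definitions using (Symmetric)
open import Relation.Binary.Construct.Union using (_∪_) renaming (symmetric to ∪-symmetric)
open import Relation.Binary.Construct.Never using (Never)
open import Relation.Binary.Construct.Closure.ReflexiveTransitive using (Star; ε; _◅_; _◅◅_; reverse)
import Relation.Binary.Construct.Closure.ReflexiveTransitive as Star
open import Relation.Binary.PropositionalEquality using (_≡_; refl; sym; trans; cong; cong₂)
open Relation.Binary.PropositionalEquality.≡-Reasoning

open import Defs

open Equivalence using (to; from)

private
  variable
    A : Set
    R Q D : Rel A 0ℓ
    P : Pred A 0ℓ
    s x w : A
    p : A × A

Reaches : Rel A 0ℓ → A → Pred A 0ℓ → Set
Reaches R s P = ∀ w → P w → Star R s w

InOneComponent : Rel A 0ℓ → Pred A 0ℓ → Set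
InOneComponent R P = ∀ u v → P u → P v → Star R u v

Arrow : A × A → Rel A 0ℓ
Arrow p x y = p ≡ (x , y)

Edge : A × A → Rel A 0ℓ
Edge p = Arrow p ∪ Arrow (swap p)

Edge-symmetric : Symmetric (Edge p)
Edge-symmetric = Sum.swap ∘ Sum.map (cong swap) (cong swap)

_⇔ʳ_ : Rel A 0ℓ → Rel A 0ℓ → Set
R ⇔ʳ Q = (R ⇒ Q) × (Q ⇒ R)

_▷_ : ∀ {y z} → Star R x y → R y z → Star R x z
p ▷ r = p ◅◅ (r ◅ ε)

reaches-mono : R ⇒ Q → Reaches R s P → Reaches Q s P
reaches-mono R⇒Q r w Pw = Star.map R⇒Q (r w Pw)

reaches-⇔ʳ : R ⇔ʳ Q → Reaches R s P ⇔ Reaches Q s P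
reaches-⇔ʳ (R⇒Q , Q⇒R) = mk⇔ (reaches-mono R⇒Q) (reaches-mono Q⇒R)

inOneComponent-⇔ʳ : R ⇔ʳ Q → InOneComponent R P ⇔ InOneComponent Q P
inOneComponent-⇔ʳ (R⇒Q , Q⇒R) =
  mk⇔ (λ c u v Pu Pv → Star.map R⇒Q (c u v Pu Pv)) (λ c u v Pu Pv → Star.map Q⇒R (c u v Pu Pv))

reaches⇔inOneComponent : Symmetric R → P s → Reaches R s P ⇔ InOneComponent R P
reaches⇔inOneComponent R-sym Ps =
  mk⇔ (λ r u v Pu Pv → reverse R-sym (r u Pu) ◅◅ r v Pv) (λ c w Pw → c _ w Ps Pw)

Absorbs : Rel A 0ℓ → A → Rel A 0ℓ → Set
Absorbs R s Q = ∀ {x y} → Q x y → Star R s x → Star R s y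

star-absorb : Absorbs R s Q → Star R s x → Star Q x w → Star R s w
star-absorb h sx ε        = sx
star-absorb h sx (q ◅ qs) = star-absorb h (h q sx) qs

reaches-absorb : Absorbs R s Q → Reaches Q s P → Reaches R s P
reaches-absorb h r w Pw = star-absorb h ε (r w Pw)

star-avoids-or-reaches-tail : Star (D ∪ Arrow p) x w → Star D x w ⊎ Star D x (proj₁ p)
star-avoids-or-reaches-tail ε                  = inj₁ ε
star-avoids-or-reaches-tail (inj₁ d ◅ path)    = Sum.map (d ◅_) (d ◅_) (star-avoids-or-reaches-tail path)
star-avoids-or-reaches-tail (inj₂ refl ◅ _)    = inj₂ ε

absorbs-arrow : Star D s (proj₂ p) → Absorbs D s (D ∪ Arrow p)
absorbs-arrow s⇝v (inj₁ d)    sx = sx ▷ d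
absorbs-arrow s⇝v (inj₂ refl) sx = s⇝v

reaches-without-edge : ∀ p →
  Reaches (D ∪ Arrow p) s P → Reaches (D ∪ Arrow (swap p)) s P → Reaches D s P
reaches-without-edge p r r˘ w Pw
  with star-avoids-or-reaches-tail (r w Pw) | star-avoids-or-reaches-tail (r˘ w Pw)
... | inj₁ s⇝w | _         = s⇝w
... | inj₂ _   | inj₁ s⇝w  = s⇝w
... | inj₂ _   | inj₂ s⇝v  = star-absorb (absorbs-arrow {p = p} s⇝v) ε (r w Pw)

absorbs-edge : Star D s (proj₁ p) → Absorbs (D ∪ Arrow p) s (D ∪ Edge p)
absorbs-edge s⇝u (inj₁ d)           sx = sx ▷ inj₁ d
absorbs-edge s⇝u (inj₂ (inj₁ refl)) sx = sx ▷ inj₂ refl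
absorbs-edge s⇝u (inj₂ (inj₂ refl)) sx = Star.map inj₁ s⇝u

absorbs-unreached-edge : ¬ Star D s (proj₁ p) → ¬ Star D s (proj₂ p) →
                         Absorbs D s (D ∪ Edge p)
absorbs-unreached-edge ¬s⇝u ¬s⇝v (inj₁ d)           sx = sx ▷ d
absorbs-unreached-edge ¬s⇝u ¬s⇝v (inj₂ (inj₁ refl)) sx = ⊥-elim (¬s⇝u sx)
absorbs-unreached-edge ¬s⇝u ¬s⇝v (inj₂ (inj₂ refl)) sx = ⊥-elim (¬s⇝v sx)

-- Whether s reaches u is not decidable here, so the case split happens under ¬ ¬;
-- the deciders in reaches-with-edge⇔ then remove it.
reaches-with-edge⇒¬¬reaches-with-arrow : ∀ p → Reaches (D ∪ Edge p) s P →
  ¬ ¬ (Reaches (D ∪ Arrow p) s P ⊎ Reaches (D ∪ Arrow (swap p)) s P)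
reaches-with-edge⇒¬¬reaches-with-arrow {D = D} {s = s} {P = P} p r ¬r =
  ¬¬-excluded-middle λ s⇝u? → ¬¬-excluded-middle λ s⇝v? → ¬r (by-cases s⇝u? s⇝v?)
  where
  by-cases : Dec (Star D s (proj₁ p)) → Dec (Star D s (proj₂ p)) →
             Reaches (D ∪ Arrow p) s P ⊎ Reaches (D ∪ Arrow (swap p)) s P
  by-cases (yes s⇝u) _          = inj₁ (reaches-absorb (absorbs-edge s⇝u) r)
  by-cases (no _)    (yes s⇝v) =
    inj₂ (reaches-absorb (absorbs-edge {p = swap p} s⇝v) (reaches-mono (Sum.map₂ Sum.swap) r))
  by-cases (no ¬s⇝u) (no ¬s⇝v) =
    inj₁ (reaches-mono inj₁ (reaches-absorb (absorbs-unreached-edge ¬s⇝u ¬s⇝v) r))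

reaches-with-edge⇔ : ∀ p →
  Dec (Reaches (D ∪ Arrow p) s P) → Dec (Reaches (D ∪ Arrow (swap p)) s P) →
  (Reaches (D ∪ Arrow p) s P ⊎ Reaches (D ∪ Arrow (swap p)) s P) ⇔ Reaches (D ∪ Edge p) s P
reaches-with-edge⇔ p r? r˘? = mk⇔
  [ reaches-mono (Sum.map₂ inj₁) , reaches-mono (Sum.map₂ inj₂) ]′
  (decidable-stable (r? ⊎-dec r˘?) ∘ reaches-with-edge⇒¬¬reaches-with-arrow p)

reaches-without-edge⇔ : ∀ p →
  (Reaches (D ∪ Arrow p) s P × Reaches (D ∪ Arrow (swap p)) s P) ⇔ Reaches D s P
reaches-without-edge⇔ p = mk⇔
  (λ (r , r˘) → reaches-without-edge p r r˘)
  (λ r → reaches-mono inj₁ r , reaches-mono inj₁ r)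

∪-assoc : ∀ {S : Rel A 0ℓ} → ((R ∪ Q) ∪ S) ⇔ʳ (R ∪ (Q ∪ S))
∪-assoc = assocʳ , assocˡ

∪-Never : R ⇔ʳ (R ∪ Never)
∪-Never = inj₁ , [ (λ r → r) , (λ ()) ]′

length-filter-map : ∀ {B C : Set} {P : Pred C 0ℓ} (P? : Decidable P) (f : B → C) xs →
                    length (filter P? (map f xs)) ≡ length (filter (P? ∘ f) xs)
length-filter-map P? f []       = refl
length-filter-map P? f (x ∷ xs) with does (P? (f x))
... | true  = cong suc (length-filter-map P? f xs)
... | false = length-filter-map P? f xs

length-filter-∪-∩ : ∀ {B : Set} {P Q : Pred B 0ℓ} (P? : Decidable P) (Q? : Decidable Q) xs →
  length (filter P? xs) + length (filter Q? xs) ≡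
  length (filter (P? ∪? Q?) xs) + length (filter (P? ∩? Q?) xs)
length-filter-∪-∩ P? Q? []       = refl
length-filter-∪-∩ P? Q? (x ∷ xs) with does (P? x) | does (Q? x)
... | true  | true  =
  cong suc (trans (+-suc _ _) (trans (cong suc (length-filter-∪-∩ P? Q? xs)) (sym (+-suc _ _))))
... | true  | false = cong suc (length-filter-∪-∩ P? Q? xs)
... | false | true  = trans (+-suc _ _) (cong suc (length-filter-∪-∩ P? Q? xs))
... | false | false = length-filter-∪-∩ P? Q? xs

count-∷ : ∀ {k} {P : Pred (Vec Bool (suc k)) 0ℓ} (P? : Decidable P) →
          count P? ≡ count (P? ∘ (true ∷_)) + count (P? ∘ (false ∷_))
count-∷ {k} P? = begin
  length (filter P? (ts ++ fs))                 ≡⟨ cong length (filter-++ P? ts fs) ⟩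
  length (filter P? ts ++ filter P? fs)         ≡⟨ length-++ (filter P? ts) ⟩
  length (filter P? ts) + length (filter P? fs)
    ≡⟨ cong₂ _+_ (length-filter-map P? (true ∷_) (allVecs k)) (length-filter-map P? (false ∷_) (allVecs k)) ⟩
  count (P? ∘ (true ∷_)) + count (P? ∘ (false ∷_)) ∎
  where
  ts fs : List (Vec Bool (suc k))
  ts = map (true ∷_) (allVecs k)
  fs = map (false ∷_) (allVecs k)

count-⇔ : ∀ {k} {P Q : Pred (Vec Bool k) 0ℓ} (P? : Decidable P) (Q? : Decidable Q) →
          (∀ v → P v ⇔ Q v) → count P? ≡ count Q?
count-⇔ {k} P? Q? P⇔Q =
  cong length (filter-≐ P? Q? ((λ {v} → to (P⇔Q v)) , (λ {v} → from (P⇔Q v))) (allVecs k))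

private
  variable
    n k : ℕ
    K : Rel (Fin n) 0ℓ

ArcOf : (Fin k → Fin n × Fin n) → Vec Bool k → Rel (Fin n) 0ℓ
ArcOf ends o x y = ∃ λ e →
  (lookup o e ≡ true × ends e ≡ (x , y)) ⊎ (lookup o e ≡ false × ends e ≡ (y , x))

AdjOf : (Fin k → Fin n × Fin n) → Subset k → Rel (Fin n) 0ℓ
AdjOf ends X x y = ∃ λ e → e ∈ X × (ends e ≡ (x , y) ⊎ ends e ≡ (y , x))

arcs-∷-true : ∀ (ends : Fin (suc k) → Fin n × Fin n) o →
  (ArcOf ends (true ∷ o) ∪ K) ⇔ʳ ((ArcOf (ends ∘ suc) o ∪ K) ∪ Arrow (ends zero))
arcs-∷-true {K = K} ends o = split , join
  where
  split : (ArcOf ends (true ∷ o) ∪ K) ⇒ ((ArcOf (ends ∘ suc) o ∪ K) ∪ Arrow (ends zero))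
  split (inj₁ (zero , inj₁ (_ , e))) = inj₂ e
  split (inj₁ (zero , inj₂ (() , _)))
  split (inj₁ (suc e , a))            = inj₁ (inj₁ (e , a))
  split (inj₂ r)                      = inj₁ (inj₂ r)
  join : ((ArcOf (ends ∘ suc) o ∪ K) ∪ Arrow (ends zero)) ⇒ (ArcOf ends (true ∷ o) ∪ K)
  join (inj₁ (inj₁ (e , a))) = inj₁ (suc e , a)
  join (inj₁ (inj₂ r))       = inj₂ r
  join (inj₂ e)              = inj₁ (zero , inj₁ (refl , e))

arcs-∷-false : ∀ (ends : Fin (suc k) → Fin n × Fin n) o →
  (ArcOf ends (false ∷ o) ∪ K) ⇔ʳ ((ArcOf (ends ∘ suc) o ∪ K) ∪ Arrow (swap (ends zero)))
arcs-∷-false {K = K} ends o = split , join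
  where
  split : (ArcOf ends (false ∷ o) ∪ K) ⇒ ((ArcOf (ends ∘ suc) o ∪ K) ∪ Arrow (swap (ends zero)))
  split (inj₁ (zero , inj₁ (() , _)))
  split (inj₁ (zero , inj₂ (_ , e))) = inj₂ (cong swap e)
  split (inj₁ (suc e , a))            = inj₁ (inj₁ (e , a))
  split (inj₂ r)                      = inj₁ (inj₂ r)
  join : ((ArcOf (ends ∘ suc) o ∪ K) ∪ Arrow (swap (ends zero))) ⇒ (ArcOf ends (false ∷ o) ∪ K)
  join (inj₁ (inj₁ (e , a))) = inj₁ (suc e , a)
  join (inj₁ (inj₂ r))       = inj₂ r
  join (inj₂ e)              = inj₁ (zero , inj₂ (refl , cong swap e))

adjs-∷-true : ∀ (ends : Fin (suc k) → Fin n × Fin n) X →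
  (AdjOf ends (true ∷ X) ∪ K) ⇔ʳ (AdjOf (ends ∘ suc) X ∪ (K ∪ Edge (ends zero)))
adjs-∷-true {K = K} ends X = split , join
  where
  split : (AdjOf ends (true ∷ X) ∪ K) ⇒ (AdjOf (ends ∘ suc) X ∪ (K ∪ Edge (ends zero)))
  split (inj₁ (zero , _ , c))          = inj₂ (inj₂ (Sum.map₂ (cong swap) c))
  split (inj₁ (suc e , there e∈X , c)) = inj₁ (e , e∈X , c)
  split (inj₂ r)                       = inj₂ (inj₁ r)
  join : (AdjOf (ends ∘ suc) X ∪ (K ∪ Edge (ends zero))) ⇒ (AdjOf ends (true ∷ X) ∪ K)
  join (inj₁ (e , e∈X , c)) = inj₁ (suc e , there e∈X , c)
  join (inj₂ (inj₁ r))      = inj₂ r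
  join (inj₂ (inj₂ c))      = inj₁ (zero , here , Sum.map₂ (cong swap) c)

adjs-∷-false : ∀ (ends : Fin (suc k) → Fin n × Fin n) X →
  (AdjOf ends (false ∷ X) ∪ K) ⇔ʳ (AdjOf (ends ∘ suc) X ∪ K)
adjs-∷-false {K = K} ends X = split , join
  where
  split : (AdjOf ends (false ∷ X) ∪ K) ⇒ (AdjOf (ends ∘ suc) X ∪ K)
  split (inj₁ (zero , () , _))
  split (inj₁ (suc e , there e∈X , c)) = inj₁ (e , e∈X , c)
  split (inj₂ r)                       = inj₂ r
  join : (AdjOf (ends ∘ suc) X ∪ K) ⇒ (AdjOf ends (false ∷ X) ∪ K)
  join (inj₁ (e , e∈X , c)) = inj₁ (suc e , there e∈X , c)
  join (inj₂ r)             = inj₂ r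

module _ (W : Subset n) (s : Fin n) where

  Oriented : (Fin k → Fin n × Fin n) → Rel (Fin n) 0ℓ → Pred (Vec Bool k) 0ℓ
  Oriented ends K o = Reaches (ArcOf ends o ∪ K) s (_∈ W)

  Connected : (Fin k → Fin n × Fin n) → Rel (Fin n) 0ℓ → Pred (Subset k) 0ℓ
  Connected ends K X = InOneComponent (AdjOf ends X ∪ K) (_∈ W)

  module _ (ends : Fin (suc k) → Fin n × Fin n) where

    oriented-either⇔contracted : Decidable (Oriented ends K) → ∀ o →
      (Oriented ends K (true ∷ o) ⊎ Oriented ends K (false ∷ o)) ⇔
      Oriented (ends ∘ suc) (K ∪ Edge (ends zero)) o
    oriented-either⇔contracted {K = K} ori? o =
      ⇔-trans (toward ⊎-⇔ away)
        (⇔-trans (reaches-with-edge⇔ (ends zero) (Dec.map toward (ori? (true ∷ o)))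
                                                 (Dec.map away (ori? (false ∷ o))))
                 (reaches-⇔ʳ ∪-assoc))
      where
      toward : Oriented ends K (true ∷ o) ⇔
               Reaches ((ArcOf (ends ∘ suc) o ∪ K) ∪ Arrow (ends zero)) s (_∈ W)
      toward = reaches-⇔ʳ (arcs-∷-true ends o)
      away : Oriented ends K (false ∷ o) ⇔
             Reaches ((ArcOf (ends ∘ suc) o ∪ K) ∪ Arrow (swap (ends zero))) s (_∈ W)
      away = reaches-⇔ʳ (arcs-∷-false ends o)

    oriented-both⇔deleted : ∀ o →
      (Oriented ends K (true ∷ o) × Oriented ends K (false ∷ o)) ⇔ Oriented (ends ∘ suc) K o
    oriented-both⇔deleted o =
      ⇔-trans (reaches-⇔ʳ (arcs-∷-true ends o) ×-⇔ reaches-⇔ʳ (arcs-∷-false ends o))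
              (reaches-without-edge⇔ (ends zero))

    oriented-contracted? : Decidable (Oriented ends K) →
                           Decidable (Oriented (ends ∘ suc) (K ∪ Edge (ends zero)))
    oriented-contracted? ori? o =
      Dec.map (oriented-either⇔contracted ori? o) ((ori? ∘ (true ∷_) ∪? ori? ∘ (false ∷_)) o)

    oriented-deleted? : Decidable (Oriented ends K) → Decidable (Oriented (ends ∘ suc) K)
    oriented-deleted? ori? o =
      Dec.map (oriented-both⇔deleted o) ((ori? ∘ (true ∷_) ∩? ori? ∘ (false ∷_)) o)

    count-oriented-∷ : (ori? : Decidable (Oriented ends K)) →
      count ori? ≡ count (oriented-contracted? ori?) + count (oriented-deleted? ori?)
    count-oriented-∷ {K = K} ori? = begin
      count ori?                                                 ≡⟨ count-∷ ori? ⟩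
      count toward? + count away?                                ≡⟨ length-filter-∪-∩ toward? away? (allVecs _) ⟩
      count (toward? ∪? away?) + count (toward? ∩? away?)
        ≡⟨ cong₂ _+_ (count-⇔ _ _ (oriented-either⇔contracted ori?)) (count-⇔ _ _ oriented-both⇔deleted) ⟩
      count (oriented-contracted? ori?) + count (oriented-deleted? ori?) ∎
      where
      toward? : Decidable (Oriented ends K ∘ (true ∷_))
      toward? = ori? ∘ (true ∷_)
      away? : Decidable (Oriented ends K ∘ (false ∷_))
      away? = ori? ∘ (false ∷_)

    connected-kept? : Decidable (Connected ends K) →
                      Decidable (Connected (ends ∘ suc) (K ∪ Edge (ends zero)))
    connected-kept? con? X = Dec.map (inOneComponent-⇔ʳ (adjs-∷-true ends X)) (con? (true ∷ X))

    connected-dropped? : Decidable (Connected ends K) → Decidable (Connected (ends ∘ suc) K)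
    connected-dropped? con? X = Dec.map (inOneComponent-⇔ʳ (adjs-∷-false ends X)) (con? (false ∷ X))

    count-connected-∷ : (con? : Decidable (Connected ends K)) →
      count con? ≡ count (connected-kept? con?) + count (connected-dropped? con?)
    count-connected-∷ con? = trans (count-∷ con?)
      (cong₂ _+_ (count-⇔ _ _ (inOneComponent-⇔ʳ ∘ adjs-∷-true ends))
                 (count-⇔ _ _ (inOneComponent-⇔ʳ ∘ adjs-∷-false ends)))

  module _ (s∈W : s ∈ W) where

    oriented⇔connected-without-edges : Symmetric K → ∀ (ends : Fin 0 → Fin n × Fin n) o →
                                       Oriented ends K o ⇔ Connected ends K o
    oriented⇔connected-without-edges {K = K} K-sym ends [] =
      ⇔-trans (reaches⇔inOneComponent (∪-symmetric {L = ArcOf ends []} (no-arc ∘ proj₁) K-sym) s∈W)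
              (inOneComponent-⇔ʳ no-edges)
      where
      no-arc : ∀ {B : Set} → Fin 0 → B
      no-arc = ⊥-elim ∘ ¬Fin0
      no-edges : (ArcOf ends [] ∪ K) ⇔ʳ (AdjOf ends [] ∪ K)
      no-edges = [ no-arc ∘ proj₁ , inj₂ ]′ , [ no-arc ∘ proj₁ , inj₂ ]′

    count-oriented≡count-connected : ∀ (ends : Fin k → Fin n × Fin n) → Symmetric K →
      (ori? : Decidable (Oriented ends K)) (con? : Decidable (Connected ends K)) →
      count ori? ≡ count con?
    count-oriented≡count-connected {zero} ends K-sym ori? con? =
      count-⇔ ori? con? (oriented⇔connected-without-edges K-sym ends)
    count-oriented≡count-connected {suc k} {K = K} ends K-sym ori? con? = begin
      count ori?
        ≡⟨ count-oriented-∷ ends ori? ⟩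
      count (oriented-contracted? ends ori?) + count (oriented-deleted? ends ori?)
        ≡⟨ cong₂ _+_ (count-oriented≡count-connected (ends ∘ suc) K∪edge-sym _ _)
                     (count-oriented≡count-connected (ends ∘ suc) K-sym _ _) ⟩
      count (connected-kept? ends con?) + count (connected-dropped? ends con?)
        ≡⟨ count-connected-∷ ends con? ⟨
      count con? ∎
      where
      K∪edge-sym : Symmetric (K ∪ Edge (ends zero))
      K∪edge-sym = ∪-symmetric {L = K} K-sym (Edge-symmetric {p = ends zero})

mainTheorem9 : ∀ {n} (G : SimpleGraph n) (W : Subset n) (s : Fin n) → s ∈ W →
                 (reach? : Decidable (AllReachable G W s)) →
                 (conn? : Decidable (WInOneComponent G W)) →
                 count reach? ≡ count conn?
mainTheorem9 G W s s∈W reach? conn? = begin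
  count reach? ≡⟨ count-⇔ reach? ori? reach⇔ori ⟩
  count ori?   ≡⟨ count-oriented≡count-connected W s s∈W (ends G) (λ ()) ori? con? ⟩
  count con?   ≡⟨ count-⇔ conn? con? conn⇔con ⟨
  count conn?  ∎
  where
  reach⇔ori : ∀ o → AllReachable G W s o ⇔ Oriented W s (ends G) Never o
  reach⇔ori o = reaches-⇔ʳ ∪-Never
  conn⇔con : ∀ X → WInOneComponent G W X ⇔ Connected W s (ends G) Never X
  conn⇔con X = inOneComponent-⇔ʳ ∪-Never
  ori? : Decidable (Oriented W s (ends G) Never)
  ori? o = Dec.map (reach⇔ori o) (reach? o)
  con? : Decidable (Connected W s (ends G) Never)
  con? X = Dec.map (conn⇔con X) (conn? X)
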